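{- Work in $\mathbf{CZF}$ and assume NID. Let $\mathcal R$ be a set of deterministic rules on a set $X$. Then the class of $\mathcal R$-closed subsets of $X$ is set-generated and there is a least $\mathcal R$-closed subset of $X$.
   Context: A rule on a set $X$ is a pair $(a,b)$ of subsets of $X$; it is deterministic if $b$ is a singleton. $Y\subseteq X$ is closed under $(a,b)$ if $a\subseteq Y$ implies $b\cap Y$ is inhabited; $Y$ is $\mathcal R$-closed if closed under all rules of $\mathcal R$. A class $M$ of subsets of $X$ is set-generated if there is a set $G\subseteq M$ with $\forall\alpha\in M\,\forall x\in\alpha\,\exists\beta\in G\,x\in\beta\subseteq\alpha$. NID: for every set $X$ and every set $\mathcal R$ of rules on $X$, the class of $\mathcal R$-closed subsets of $X$ is set-generated. -}

module Defs where

open import Level using (0ℓ)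
open import Data.Product using (Σ; ∃; _×_)
open import Relation.Binary.PropositionalEquality using (_≡_)
open import Relation.Unary using (Pred; _⊆_; _∈_)

-- CZF sets are modelled by small types (Set); subsets of X by predicates
-- Pred X 0ℓ. A "set of rules" on X is a family of rules indexed by a small type.

record Rule (X : Set) : Set₁ where
  constructor _▷_
  field
    premises   : Pred X 0ℓ
    conclusion : Pred X 0ℓ
open Rule public

record RuleSet (X : Set) : Set₁ where
  field
    Index : Set
    rule  : Index → Rule X
open RuleSet public

IsSingleton : {X : Set} → Pred X 0ℓ → Set
IsSingleton {X} b = Σ X λ y → (y ∈ b) × (∀ z → z ∈ b → z ≡ y)

Deterministic : {X : Set} → Rule X → Set
Deterministic r = IsSingleton (conclusion r)

ClosedUnder : {X : Set} → Rule X → Pred X 0ℓ → Set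
ClosedUnder {X} r Y = premises r ⊆ Y → ∃ λ (x : X) → x ∈ conclusion r × x ∈ Y

RClosed : {X : Set} → RuleSet X → Pred X 0ℓ → Set
RClosed R Y = ∀ (i : Index R) → ClosedUnder (rule R i) Y

SetGenerated : {X : Set} → (Pred X 0ℓ → Set) → Set₁
SetGenerated {X} M =
  Σ Set λ I → Σ (I → Pred X 0ℓ) λ G →
    (∀ i → M (G i)) ×
    (∀ (α : Pred X 0ℓ) → M α → ∀ (x : X) → x ∈ α →
       Σ I λ i → x ∈ G i × G i ⊆ α)

NID : Set₁
NID = (X : Set) (R : RuleSet X) → SetGenerated (RClosed R)

IsLeastRClosed : {X : Set} → RuleSet X → Pred X 0ℓ → Set₁
IsLeastRClosed R L = RClosed R L × (∀ (Y : Pred _ 0ℓ) → RClosed R Y → L ⊆ Y)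

-- Adjoin a fresh point ⋆ to X and apply NID to the rules of R, read on X ⊎ {⋆}.
-- For any R-closed Y, the set Y ∪ {⋆} is closed, so some generator through ⋆
-- lies inside it; hence the intersection L of all generators through ⋆, cut
-- down to X, is contained in every R-closed set. Since the rules are
-- deterministic, intersections of closed sets are closed, so L is R-closed.
module Submission where

open import Defs
open import Level using (0ℓ)
open import Data.Product using (Σ; _×_; _,_)
open import Data.Sum using (_⊎_; inj₁; inj₂)
open import Data.Unit using (⊤; tt)
open import Data.Empty using (⊥)
open import Function using (_∘_)
open import Relation.Unary using (Pred; _∈_; _⊆_; ⋂)
open import Relation.Binary.PropositionalEquality using (subst)

module _ {X : Set} where

  ⋆ : X ⊎ ⊤
  ⋆ = inj₂ tt

  embed : Pred X 0ℓ → Pred (X ⊎ ⊤) 0ℓ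
  embed P (inj₁ x) = P x
  embed P (inj₂ _) = ⊥

  embed⋆ : Pred X 0ℓ → Pred (X ⊎ ⊤) 0ℓ
  embed⋆ P (inj₁ x) = P x
  embed⋆ P (inj₂ _) = ⊤

  embedRules : RuleSet X → RuleSet (X ⊎ ⊤)
  embedRules R = record
    { Index = Index R
    ; rule  = λ i → embed (premises (rule R i)) ▷ embed (conclusion (rule R i))
    }

  restrict-closed : (R : RuleSet X) (Z : Pred (X ⊎ ⊤) 0ℓ) →
    RClosed (embedRules R) Z → RClosed R (Z ∘ inj₁)
  restrict-closed R Z Z-closed i a⊆Z
    with Z-closed i (λ { {inj₁ _} a∋x → a⊆Z a∋x ; {inj₂ _} () })
  ... | inj₁ w , b∋w , Z∋w = w , b∋w , Z∋w

  embed⋆-closed : (R : RuleSet X) (Y : Pred X 0ℓ) →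
    RClosed R Y → RClosed (embedRules R) (embed⋆ Y)
  embed⋆-closed R Y Y-closed i a⊆Y
    with Y-closed i (λ {x} a∋x → a⊆Y {inj₁ x} a∋x)
  ... | w , b∋w , Y∋w = inj₁ w , b∋w , Y∋w

  ⋂-closed : (R : RuleSet X) → (∀ i → Deterministic (rule R i)) →
    (J : Set) (F : J → Pred X 0ℓ) → (∀ j → RClosed R (F j)) →
    RClosed R (⋂ J F)
  ⋂-closed R det J F F-closed i a⊆⋂F with det i
  ... | y , b∋y , b≡y = y , b∋y , y∈F
    where
    y∈F : ∀ j → F j y
    y∈F j with F-closed j i (λ a∋x → a⊆⋂F a∋x j)
    ... | w , b∋w , F∋w = subst (F j) (b≡y w b∋w) F∋w

proposition3p6 : NID → (X : Set) (R : RuleSet X) →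
    (∀ (i : Index R) → Deterministic (rule R i)) →
    SetGenerated (RClosed R) × Σ (Pred X 0ℓ) (λ L → IsLeastRClosed R L)
proposition3p6 nid X R det with nid (X ⊎ ⊤) (embedRules R)
... | I , G , G-closed , G-covers = nid X R , L , L-closed , L-least
  where
  Through⋆ : Set
  Through⋆ = Σ I λ i → ⋆ ∈ G i

  L : Pred X 0ℓ
  L = ⋂ Through⋆ λ { (i , _) → G i ∘ inj₁ }

  L-closed : RClosed R L
  L-closed = ⋂-closed R det Through⋆ _
    λ { (i , _) → restrict-closed R (G i) (G-closed i) }

  L-least : ∀ (Y : Pred X 0ℓ) → RClosed R Y → L ⊆ Y
  L-least Y Y-closed L∋x with G-covers (embed⋆ Y) (embed⋆-closed R Y Y-closed) ⋆ tt
  ... | i , G∋⋆ , G⊆Y = G⊆Y (L∋x (i , G∋⋆))
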